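{- Let $\mathbf{k}$ be a field and let $i,j$ be integers with $i+2\le j\le 2i+2$. If $G$ is a triangle-free finite simple graph with $\beta_{i,j}(I_G)=0$, then $\chi(G)\le j-1$.
   Context: $\chi(G)$ is the chromatic number. The independence complex $\mathrm{Ind}(G)$ is the simplicial complex on $V(G)$ whose faces are the independent sets of $G$. The edge ideal $I_G\subseteq \mathbf{k}[x_v\mid v\in V(G)]$ is generated by $x_ux_v$ for edges $uv$, and \[\beta_{i,j}(I_G)=\sum_{W\subseteq V(G),\,|W|=j}\dim_{\mathbf{k}}\tilde H_{j-i-2}(\mathrm{Ind}(G[W]);\mathbf{k}),\] with $G[W]$ the induced subgraph on $W$ and $\tilde H$ reduced simplicial homology. -}

module Defs where

open import Level using (Level; _⊔_; suc)
open import Algebra.Bundles using (CommutativeRing)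
open import Data.Nat as ℕ using (ℕ; zero; _∸_)
open import Data.Bool using (Bool; true; false; if_then_else_)
open import Data.Fin using (Fin; _<_)
open import Data.Fin.Subset using (Subset; _∈_; _∉_; _⊆_; ∣_∣; _∪_; ⁅_⁆)
open import Data.Fin.Subset.Properties using (_∈?_)
open import Data.Fin.Properties using (_<?_)
open import Data.List using (List; foldr; map; filter; length)
open import Data.List.Base using (allFin)
open import Data.Product using (Σ; ∃; _×_)
open import Relation.Binary.PropositionalEquality using (_≡_; _≢_)
open import Relation.Nullary using (¬_; yes; no)

record Field (c ℓ : Level) : Set (Level.suc (c ⊔ ℓ)) where
  field
    commutativeRing : CommutativeRing c ℓ
  open CommutativeRing commutativeRing public
  field
    1≉0     : ¬ (1# ≈ 0#)
    inverse : ∀ x → ¬ (x ≈ 0#) → Σ Carrier (λ y → x * y ≈ 1#)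

record Graph (n : ℕ) : Set where
  field
    adj   : Fin n → Fin n → Bool
    sym   : ∀ u v → adj u v ≡ adj v u
    irref : ∀ v → adj v v ≡ false

module _ {n : ℕ} (G : Graph n) where
  open Graph G

  TriangleFree : Set
  TriangleFree = ∀ u v w → adj u v ≡ true → adj v w ≡ true → adj u w ≡ true → Data.Empty.⊥
    where import Data.Empty

  ProperColouring : ℕ → Set
  ProperColouring m = Σ (Fin n → Fin m) (λ col → ∀ u v → adj u v ≡ true → col u ≢ col v)

  ChromaticAtMost : ℕ → Set
  ChromaticAtMost m = ProperColouring m

  Independent : Subset n → Set
  Independent σ = ∀ u v → u ∈ σ → v ∈ σ → adj u v ≡ false

  -- Faces of Ind(G[W]) with s vertices (i.e. of dimension s-1);
  -- s = 0 gives the empty face, so this yields the augmented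
  -- (reduced) chain complex.
  FaceOfSize : Subset n → ℕ → Subset n → Set
  FaceOfSize W s σ = σ ⊆ W × Independent σ × ∣ σ ∣ ≡ s

module Chains {c ℓ : Level} (k : Field c ℓ) {n : ℕ} where
  open Field k

  Σ-Fin : (Fin n → Carrier) → Carrier
  Σ-Fin f = foldr (λ v acc → f v + acc) 0# (allFin n)

  below : Subset n → Fin n → ℕ
  below τ v = length (filter (λ u → u <? v) (filter (λ u → u ∈? τ) (allFin n)))

  signed : ℕ → Carrier → Carrier
  signed zero x = x
  signed (ℕ.suc zero) x = - x
  signed (ℕ.suc (ℕ.suc m)) x = signed m x

  -- A chain is a k-valued function on subsets (faces), the simplices being
  -- oriented by the order of Fin n.  The boundary map
  --   ∂ [v₀ < … < v_q] = Σ_t (-1)^t [v₀ … v̂_t … v_q]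
  -- evaluated at a face τ:
  --   (∂ c)(τ) = Σ_{v ∉ τ} (-1)^{#{u ∈ τ | u < v}} c(τ ∪ {v}).
  ∂ : (Subset n → Carrier) → (Subset n → Carrier)
  ∂ c τ = Σ-Fin (λ v → if does (v ∈? τ) then 0# else signed (below τ v) (c (τ ∪ ⁅ v ⁆)))
    where open import Relation.Nullary using (does)

  IsChain : Graph n → Subset n → ℕ → (Subset n → Carrier) → Set ℓ
  IsChain G W s ch = ∀ σ → ¬ FaceOfSize G W s σ → ch σ ≈ 0#

  -- H̃_{s-1}(Ind(G[W]); k) = 0 : every cycle in C_{s-1} is a boundary.
  ReducedHomologyVanishes : Graph n → Subset n → ℕ → Set (c ⊔ ℓ)
  ReducedHomologyVanishes G W s =
    ∀ (z : Subset n → Carrier) → IsChain G W s z → (∀ τ → ∂ z τ ≈ 0#) →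
      Σ (Subset n → Carrier) (λ d → IsChain G W (ℕ.suc s) d × (∀ σ → ∂ d σ ≈ z σ))

  -- β_{i,j}(I_G) = 0 : since β_{i,j} is a sum of dimensions
  -- dim H̃_{j-i-2}(Ind(G[W])) over |W| = j, it vanishes iff each summand does.
  -- (Here j-i-2 = s-1 with s = j-i-1.)
  BettiZero : Graph n → ℕ → ℕ → Set (c ⊔ ℓ)
  BettiZero G i j = ∀ (W : Subset n) → ∣ W ∣ ≡ j → ReducedHomologyVanishes G W (j ∸ i ∸ 1)

module Submission where

-- Write i = t + r and j = i + t + 2, so that β_{i,j}(I_G) = 0 says H̃_t(Ind(G[W])) = 0 for all
-- |W| = j.  By induction on t, every vertex set U either has a proper colouring with r + 1 + 2t
-- colours, or contains some W of size j carrying a t-cycle z of Ind(G[W]) that is nonzero on a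
-- face τ₀ dominating W.  A dominating face lies in no larger face, so every boundary vanishes at
-- τ₀ and z is not a boundary.
-- For t = 0, either all degrees in U are at most r and the greedy colouring uses r + 1 colours,
-- or a vertex with r + 1 neighbours spans a star, whose independence complex is disconnected.
-- For t + 1, pick an edge uv of U and recurse on the vertices adjacent to neither.  A colouring
-- there extends by two colours, since N(u) and N(v) are independent in a triangle-free graph;
-- a witness there extends to W ∪ {u} ∪ {v}, with the suspension cone_u z − cone_v z as the
-- new cycle and τ₀ ∪ {u} as the new dominating face.

open import Defs
open import Level using (Level; _⊔_)
open import Function using (_∘_; id)
open import Data.Nat as ℕ using (ℕ; zero; suc; _≤_; _∸_; z≤n; s≤s)
import Data.Nat.Properties as ℕₚ
open import Data.Bool using (Bool; true; false; if_then_else_; _∧_; _∨_; not)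
import Data.Bool.Properties as Boolₚ
open import Data.Fin as Fin using (Fin; zero; suc; toℕ; _<_)
open import Data.Fin.Properties using (_≟_; _<?_; <-cmp)
import Data.Fin.Properties as Finₚ
open import Data.Fin.Subset using (Subset; _∈_; _∉_; _⊆_; _∪_; _─_; ⁅_⁆; ∣_∣; ⊥; ⊤; Nonempty)
  renaming (_-_ to _⊖_)
open import Data.Fin.Subset.Properties
open import Data.Vec as Vec using ([]; _∷_; here; there)
import Data.Vec.Properties as Vecₚ
open import Data.List as List using (List; filter; length; tabulate; allFin)
open import Data.List.Properties using (filter-accept; filter-reject)
open import Data.Product using (Σ; ∃; ∃₂; _×_; _,_; proj₁; proj₂)
open import Data.Sum using (_⊎_; inj₁; inj₂)
open import Data.Empty using (⊥-elim)
open import Relation.Nullary using (¬_; ¬?; Dec; yes; no; does; contradiction; _×-dec_)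
open import Relation.Nullary.Decidable using (dec-true; dec-false; decidable-stable)
open import Relation.Binary using (tri<; tri≈; tri>)
open import Relation.Binary.PropositionalEquality as ≡ using (_≡_; _≢_; refl; cong; cong₂)

x∈p∪⁅x⁆ : ∀ {n} (p : Subset n) x → x ∈ p ∪ ⁅ x ⁆
x∈p∪⁅x⁆ p x = x∈p∪q⁺ (inj₂ (x∈⁅x⁆ x))

x∉p∪⁅y⁆ : ∀ {n x} (p : Subset n) y → x ∉ p → x ≢ y → x ∉ p ∪ ⁅ y ⁆
x∉p∪⁅y⁆ p y x∉p x≢y x∈ with x∈p∪q⁻ p ⁅ y ⁆ x∈
... | inj₁ x∈p = x∉p x∈p
... | inj₂ x∈⁅y⁆ = x≢y (x∈⁅y⁆⇒x≡y y x∈⁅y⁆)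

subst-∈⁅⁆ : ∀ {n} (P : Fin n → Set) {x y} → P x → y ∈ ⁅ x ⁆ → P y
subst-∈⁅⁆ P {x} Px y∈⁅x⁆ = ≡.subst P (≡.sym (x∈⁅y⁆⇒x≡y x y∈⁅x⁆)) Px

x∉p⊖x : ∀ {n} (p : Subset n) x → x ∉ p ⊖ x
x∉p⊖x (_ ∷ p) zero    ()
x∉p⊖x (_ ∷ p) (suc x) (there x∈) = x∉p⊖x p x x∈

p∪⁅x⁆⊖x≡p : ∀ {n} (p : Subset n) x → x ∉ p → (p ∪ ⁅ x ⁆) ⊖ x ≡ p
p∪⁅x⁆⊖x≡p (false ∷ p) zero    _   = cong (false ∷_) (≡.trans (cong (_─ ⊥) (∪-identityʳ p)) (p─⊥≡p p))
p∪⁅x⁆⊖x≡p (true  ∷ p) zero    x∉p = contradiction here x∉p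
p∪⁅x⁆⊖x≡p (false ∷ p) (suc x) x∉p = cong (false ∷_) (p∪⁅x⁆⊖x≡p p x (x∉p ∘ there))
p∪⁅x⁆⊖x≡p (true  ∷ p) (suc x) x∉p = cong (true ∷_) (p∪⁅x⁆⊖x≡p p x (x∉p ∘ there))

p⊖x∪⁅x⁆≡p : ∀ {n} (p : Subset n) x → x ∈ p → (p ⊖ x) ∪ ⁅ x ⁆ ≡ p
p⊖x∪⁅x⁆≡p (true  ∷ p) zero    here       = cong (true ∷_) (≡.trans (∪-identityʳ _) (p─⊥≡p p))
p⊖x∪⁅x⁆≡p (false ∷ p) (suc x) (there x∈) = cong (false ∷_) (p⊖x∪⁅x⁆≡p p x x∈)
p⊖x∪⁅x⁆≡p (true  ∷ p) (suc x) (there x∈) = cong (true ∷_) (p⊖x∪⁅x⁆≡p p x x∈)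

p∪⁅y⁆⊖x≡p⊖x∪⁅y⁆ : ∀ {n} (p : Subset n) y x → y ≢ x → (p ∪ ⁅ y ⁆) ⊖ x ≡ (p ⊖ x) ∪ ⁅ y ⁆
p∪⁅y⁆⊖x≡p⊖x∪⁅y⁆ (b     ∷ p) zero    zero    y≢x = contradiction refl y≢x
p∪⁅y⁆⊖x≡p⊖x∪⁅y⁆ (b     ∷ p) zero    (suc x) _   =
  cong (_ ∷_) (≡.trans (cong (_⊖ x) (∪-identityʳ p)) (≡.sym (∪-identityʳ _)))
p∪⁅y⁆⊖x≡p⊖x∪⁅y⁆ (b     ∷ p) (suc y) zero    _   =
  cong (false ∷_) (≡.trans (p─⊥≡p _) (cong (_∪ ⁅ y ⁆) (≡.sym (p─⊥≡p p))))
p∪⁅y⁆⊖x≡p⊖x∪⁅y⁆ (false ∷ p) (suc y) (suc x) y≢x = cong (false ∷_) (p∪⁅y⁆⊖x≡p⊖x∪⁅y⁆ p y x (y≢x ∘ cong suc))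
p∪⁅y⁆⊖x≡p⊖x∪⁅y⁆ (true  ∷ p) (suc y) (suc x) y≢x = cong (true ∷_) (p∪⁅y⁆⊖x≡p⊖x∪⁅y⁆ p y x (y≢x ∘ cong suc))

∣p∪q∣≡∣p∣+∣q∣ : ∀ {n} (p q : Subset n) → (∀ {x} → x ∈ p → x ∉ q) → ∣ p ∪ q ∣ ≡ ∣ p ∣ ℕ.+ ∣ q ∣
∣p∪q∣≡∣p∣+∣q∣ []          []          _    = refl
∣p∪q∣≡∣p∣+∣q∣ (true  ∷ p) (true  ∷ q) disj = contradiction here (disj here)
∣p∪q∣≡∣p∣+∣q∣ (true  ∷ p) (false ∷ q) disj = cong suc (∣p∪q∣≡∣p∣+∣q∣ p q λ x∈p x∈q → disj (there x∈p) (there x∈q))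
∣p∪q∣≡∣p∣+∣q∣ (false ∷ p) (true  ∷ q) disj =
  ≡.trans (cong suc (∣p∪q∣≡∣p∣+∣q∣ p q λ x∈p x∈q → disj (there x∈p) (there x∈q))) (≡.sym (ℕₚ.+-suc ∣ p ∣ ∣ q ∣))
∣p∪q∣≡∣p∣+∣q∣ (false ∷ p) (false ∷ q) disj = ∣p∪q∣≡∣p∣+∣q∣ p q λ x∈p x∈q → disj (there x∈p) (there x∈q)

∣p∪⁅x⁆∣≡1+∣p∣ : ∀ {n} (p : Subset n) x → x ∉ p → ∣ p ∪ ⁅ x ⁆ ∣ ≡ suc ∣ p ∣
∣p∪⁅x⁆∣≡1+∣p∣ p x x∉p = begin
  ∣ p ∪ ⁅ x ⁆ ∣    ≡⟨ ∣p∪q∣≡∣p∣+∣q∣ p ⁅ x ⁆ (λ y∈p y∈⁅x⁆ → x∉p (≡.subst (_∈ p) (x∈⁅y⁆⇒x≡y x y∈⁅x⁆) y∈p)) ⟩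
  ∣ p ∣ ℕ.+ ∣ ⁅ x ⁆ ∣ ≡⟨ cong (∣ p ∣ ℕ.+_) (∣⁅x⁆∣≡1 x) ⟩
  ∣ p ∣ ℕ.+ 1         ≡⟨ ℕₚ.+-comm ∣ p ∣ 1 ⟩
  suc ∣ p ∣         ∎
  where open ≡.≡-Reasoning

∣p∣≡1+∣p⊖x∣ : ∀ {n} (p : Subset n) x → x ∈ p → ∣ p ∣ ≡ suc ∣ p ⊖ x ∣
∣p∣≡1+∣p⊖x∣ p x x∈p = ≡.trans (cong ∣_∣ (≡.sym (p⊖x∪⁅x⁆≡p p x x∈p))) (∣p∪⁅x⁆∣≡1+∣p∣ (p ⊖ x) x (x∉p⊖x p x))

∣p∪q∣≤∣p∣+∣q∣ : ∀ {n} (p q : Subset n) → ∣ p ∪ q ∣ ≤ ∣ p ∣ ℕ.+ ∣ q ∣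
∣p∪q∣≤∣p∣+∣q∣ []          []          = z≤n
∣p∪q∣≤∣p∣+∣q∣ (true  ∷ p) (true  ∷ q) = s≤s (ℕₚ.≤-trans (∣p∪q∣≤∣p∣+∣q∣ p q) (ℕₚ.+-monoʳ-≤ ∣ p ∣ (ℕₚ.n≤1+n ∣ q ∣)))
∣p∪q∣≤∣p∣+∣q∣ (true  ∷ p) (false ∷ q) = s≤s (∣p∪q∣≤∣p∣+∣q∣ p q)
∣p∪q∣≤∣p∣+∣q∣ (false ∷ p) (true  ∷ q) =
  ℕₚ.≤-trans (s≤s (∣p∪q∣≤∣p∣+∣q∣ p q)) (ℕₚ.≤-reflexive (≡.sym (ℕₚ.+-suc ∣ p ∣ ∣ q ∣)))
∣p∪q∣≤∣p∣+∣q∣ (false ∷ p) (false ∷ q) = ∣p∪q∣≤∣p∣+∣q∣ p q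

∃-⊆-of-size : ∀ {n} (p : Subset n) k → k ≤ ∣ p ∣ → ∃ λ q → q ⊆ p × ∣ q ∣ ≡ k
∃-⊆-of-size {n} p zero _ = ⊥ , (λ x∈⊥ → contradiction x∈⊥ ∉⊥) , ∣⊥∣≡0 n
∃-⊆-of-size (true ∷ p) (suc k) (s≤s k≤∣p∣) with ∃-⊆-of-size p k k≤∣p∣
... | q , q⊆p , ∣q∣≡k = true ∷ q , (λ { here → here ; (there x∈q) → there (q⊆p x∈q) }) , cong suc ∣q∣≡k
∃-⊆-of-size (false ∷ p) (suc k) k<∣p∣ with ∃-⊆-of-size p (suc k) k<∣p∣
... | q , q⊆p , ∣q∣≡k = false ∷ q , (λ { (there x∈q) → there (q⊆p x∈q) }) , ∣q∣≡k

0<∣p∣⇒Nonempty : ∀ {n} (p : Subset n) → 0 ℕ.< ∣ p ∣ → Nonempty p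
0<∣p∣⇒Nonempty {n} p 0<∣p∣ with nonempty? p
... | yes p≠∅ = p≠∅
... | no  p≡∅ = contradiction (≡.trans (cong ∣_∣ (Empty-unique p≡∅)) (∣⊥∣≡0 n)) (ℕₚ.>⇒≢ 0<∣p∣)

-- Chains.below τ v unfolds to countBelow τ v (allFin n); below′ is its structural form.
countBelow : ∀ {n} → Subset n → Fin n → List (Fin n) → ℕ
countBelow τ v xs = length (filter (λ u → u <? v) (filter (λ u → u ∈? τ) xs))

module _ {n} (τ : Subset n) (v : Fin n) {x : Fin n} (xs : List (Fin n)) where

  countBelow-∉ : x ∉ τ → countBelow τ v (x List.∷ xs) ≡ countBelow τ v xs
  countBelow-∉ x∉τ = cong (length ∘ filter (_<? v)) (filter-reject (_∈? τ) x∉τ)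

  countBelow-≮ : x ∈ τ → ¬ x < v → countBelow τ v (x List.∷ xs) ≡ countBelow τ v xs
  countBelow-≮ x∈τ x≮v = ≡.trans (cong (length ∘ filter (_<? v)) (filter-accept (_∈? τ) x∈τ))
                               (cong length (filter-reject (_<? v) x≮v))

  countBelow-< : x ∈ τ → x < v → countBelow τ v (x List.∷ xs) ≡ suc (countBelow τ v xs)
  countBelow-< x∈τ x<v = ≡.trans (cong (length ∘ filter (_<? v)) (filter-accept (_∈? τ) x∈τ))
                               (cong length (filter-accept (_<? v) x<v))

countBelow-suc : ∀ {n} b (τ : Subset n) v {m} (g : Fin m → Fin n) →
                 countBelow (b ∷ τ) (suc v) (tabulate (suc ∘ g)) ≡ countBelow τ v (tabulate g)
countBelow-suc b τ v {zero}  g = refl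
countBelow-suc {n} b τ v {suc m} g = step (x ∈? τ) (x <? v)
  where
  x : Fin n
  x = g zero
  ih : countBelow (b ∷ τ) (suc v) (tabulate (suc ∘ g ∘ suc)) ≡ countBelow τ v (tabulate (g ∘ suc))
  ih = countBelow-suc b τ v (g ∘ suc)
  step : Dec (x ∈ τ) → Dec (x < v) →
         countBelow (b ∷ τ) (suc v) (tabulate (suc ∘ g)) ≡ countBelow τ v (tabulate g)
  step (no x∉τ) _ = ≡.trans (countBelow-∉ (b ∷ τ) (suc v) _ (x∉τ ∘ drop-there))
                          (≡.trans ih (≡.sym (countBelow-∉ τ v _ x∉τ)))
  step (yes x∈τ) (no x≮v) = ≡.trans (countBelow-≮ (b ∷ τ) (suc v) _ (there x∈τ) (x≮v ∘ ℕₚ.≤-pred))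
                                  (≡.trans ih (≡.sym (countBelow-≮ τ v _ x∈τ x≮v)))
  step (yes x∈τ) (yes x<v) = ≡.trans (countBelow-< (b ∷ τ) (suc v) _ (there x∈τ) (s≤s x<v))
                                   (≡.trans (cong suc ih) (≡.sym (countBelow-< τ v _ x∈τ x<v)))

below′ : ∀ {n} → Subset n → Fin n → ℕ
below′ (b     ∷ τ) zero    = 0
below′ (true  ∷ τ) (suc v) = suc (below′ τ v)
below′ (false ∷ τ) (suc v) = below′ τ v

countBelow-zero : ∀ {n} (τ : Subset (suc n)) xs → countBelow τ zero xs ≡ 0
countBelow-zero τ List.[]  = refl
countBelow-zero τ (x List.∷ xs) = step (x ∈? τ)
  where
  step : Dec (x ∈ τ) → countBelow τ zero (x List.∷ xs) ≡ 0
  step (yes x∈τ) = ≡.trans (countBelow-≮ τ zero xs x∈τ λ ()) (countBelow-zero τ xs)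
  step (no  x∉τ) = ≡.trans (countBelow-∉ τ zero xs x∉τ) (countBelow-zero τ xs)

countBelow-allFin : ∀ {n} (τ : Subset n) v → countBelow τ v (allFin n) ≡ below′ τ v
countBelow-allFin (b     ∷ τ) zero    = countBelow-zero (b ∷ τ) (allFin _)
countBelow-allFin (true  ∷ τ) (suc v) =
  ≡.trans (countBelow-< (true ∷ τ) (suc v) {zero} (tabulate suc) here (s≤s z≤n))
        (cong suc (≡.trans (countBelow-suc true τ v id) (countBelow-allFin τ v)))
countBelow-allFin (false ∷ τ) (suc v) =
  ≡.trans (countBelow-∉ (false ∷ τ) (suc v) {zero} (tabulate suc) λ ())
        (≡.trans (countBelow-suc false τ v id) (countBelow-allFin τ v))

below′-∪⁅x⁆-< : ∀ {n} (σ : Subset n) x y → x ∉ σ → x < y → below′ (σ ∪ ⁅ x ⁆) y ≡ suc (below′ σ y)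
below′-∪⁅x⁆-< (false ∷ σ) zero    (suc y) _   _         = cong (λ τ → suc (below′ τ y)) (∪-identityʳ σ)
below′-∪⁅x⁆-< (true  ∷ σ) zero    (suc y) x∉σ _         = contradiction here x∉σ
below′-∪⁅x⁆-< (false ∷ σ) (suc x) (suc y) x∉σ (s≤s x<y) = below′-∪⁅x⁆-< σ x y (x∉σ ∘ there) x<y
below′-∪⁅x⁆-< (true  ∷ σ) (suc x) (suc y) x∉σ (s≤s x<y) = cong suc (below′-∪⁅x⁆-< σ x y (x∉σ ∘ there) x<y)

below′-∪⁅x⁆-≮ : ∀ {n} (σ : Subset n) x y → ¬ x < y → below′ (σ ∪ ⁅ x ⁆) y ≡ below′ σ y
below′-∪⁅x⁆-≮ (b     ∷ σ) zero    zero    _   = refl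
below′-∪⁅x⁆-≮ (b     ∷ σ) (suc x) zero    _   = refl
below′-∪⁅x⁆-≮ (b     ∷ σ) zero    (suc y) x≮y = contradiction (s≤s z≤n) x≮y
below′-∪⁅x⁆-≮ (false ∷ σ) (suc x) (suc y) x≮y = below′-∪⁅x⁆-≮ σ x y (x≮y ∘ s≤s)
below′-∪⁅x⁆-≮ (true  ∷ σ) (suc x) (suc y) x≮y = cong suc (below′-∪⁅x⁆-≮ σ x y (x≮y ∘ s≤s))

module SignedSums {c ℓ : Level} (k : Field c ℓ) {n : ℕ} where
  open Field k hiding (refl; zero)
  open Field k using () renaming (refl to ≈-refl)
  open Chains k {n} using (Σ-Fin; signed)
  open import Algebra.Properties.AbelianGroup +-abelianGroup
    using (ε⁻¹≈ε; ⁻¹-involutive; ⁻¹-∙-comm; inverseʳ-unique)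
  open import Algebra.Properties.CommutativeMonoid.Sum +-commutativeMonoid public
    using (sum; sum-cong-≋)
  open import Algebra.Properties.CommutativeMonoid.Sum +-commutativeMonoid
    using (∑-distrib-+; sum-remove; sum-replicate-zero)
  open import Relation.Binary.Reasoning.Setoid setoid

  foldr-tabulate : ∀ {m} (g : Fin m → Fin n) (f : Fin n → Carrier) →
                   List.foldr (λ v acc → f v + acc) 0# (tabulate g) ≡ sum (f ∘ g)
  foldr-tabulate {zero}  g f = refl
  foldr-tabulate {suc m} g f = cong (f (g zero) +_) (foldr-tabulate (g ∘ suc) f)

  Σ-Fin≡sum : ∀ f → Σ-Fin f ≡ sum f
  Σ-Fin≡sum = foldr-tabulate id

  sum-zero : ∀ {m} (f : Fin m → Carrier) → (∀ v → f v ≈ 0#) → sum f ≈ 0#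
  sum-zero {m} f f≈0 = trans (sum-cong-≋ f≈0) (sum-replicate-zero m)

  sum-neg : ∀ {m} (f : Fin m → Carrier) → sum (λ v → - f v) ≈ - sum f
  sum-neg f = inverseʳ-unique (sum f) _ (begin
    sum f + sum (λ v → - f v)  ≈⟨ ∑-distrib-+ f _ ⟨
    sum (λ v → f v - f v)      ≈⟨ sum-zero _ (λ v → -‿inverseʳ (f v)) ⟩
    0#                         ∎)

  sum-sub : ∀ {m} (f g : Fin m → Carrier) → sum (λ v → f v - g v) ≈ sum f - sum g
  sum-sub f g = trans (∑-distrib-+ f _) (+-congˡ (sum-neg g))

  sum-single : ∀ {m} (f : Fin m → Carrier) a → (∀ v → v ≢ a → f v ≈ 0#) → sum f ≈ f a
  sum-single {suc m} f a f≈0 = begin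
    sum f                        ≈⟨ sum-remove {i = a} f ⟩
    f a + sum (f ∘ Fin.punchIn a) ≈⟨ +-congˡ (sum-zero _ (λ v → f≈0 _ (Finₚ.punchInᵢ≢i a v))) ⟩
    f a + 0#                     ≈⟨ +-identityʳ (f a) ⟩
    f a                          ∎

  signed-cong : ∀ m {x y} → x ≈ y → signed m x ≈ signed m y
  signed-cong zero          = λ x≈y → x≈y
  signed-cong (suc zero)    = -‿cong
  signed-cong (suc (suc m)) = signed-cong m

  signed-suc : ∀ m x → signed (suc m) x ≈ - signed m x
  signed-suc zero          x = ≈-refl
  signed-suc (suc zero)    x = sym (⁻¹-involutive x)
  signed-suc (suc (suc m)) x = signed-suc m x

  signed-+ : ∀ m p x → signed (m ℕ.+ p) x ≈ signed m (signed p x)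
  signed-+ zero          p x = ≈-refl
  signed-+ (suc zero)    p x = signed-suc p x
  signed-+ (suc (suc m)) p x = signed-+ m p x

  signed-comm : ∀ m p x → signed m (signed p x) ≈ signed p (signed m x)
  signed-comm m p x = begin
    signed m (signed p x) ≈⟨ signed-+ m p x ⟨
    signed (m ℕ.+ p) x    ≡⟨ cong (λ q → signed q x) (ℕₚ.+-comm m p) ⟩
    signed (p ℕ.+ m) x    ≈⟨ signed-+ p m x ⟩
    signed p (signed m x) ∎

  signed-involutive : ∀ m x → signed m (signed m x) ≈ x
  signed-involutive zero          x = ≈-refl
  signed-involutive (suc zero)    x = ⁻¹-involutive x
  signed-involutive (suc (suc m)) x = signed-involutive m x

  signed-neg : ∀ m x → signed m (- x) ≈ - signed m x
  signed-neg zero          x = ≈-refl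
  signed-neg (suc zero)    x = ≈-refl
  signed-neg (suc (suc m)) x = signed-neg m x

  signed-0# : ∀ m → signed m 0# ≈ 0#
  signed-0# zero          = ≈-refl
  signed-0# (suc zero)    = ε⁻¹≈ε
  signed-0# (suc (suc m)) = signed-0# m

  -signed-0# : ∀ m → - signed m 0# ≈ 0#
  -signed-0# m = trans (-‿cong (signed-0# m)) ε⁻¹≈ε

  signed-≈0# : ∀ m {x} → signed m x ≈ 0# → x ≈ 0#
  signed-≈0# m {x} sx≈0 = begin
    x                     ≈⟨ signed-involutive m x ⟨
    signed m (signed m x) ≈⟨ signed-cong m sx≈0 ⟩
    signed m 0#           ≈⟨ signed-0# m ⟩
    0#                    ∎

  signed-sub : ∀ m x y → signed m (x - y) ≈ signed m x - signed m y
  signed-sub zero          x y = ≈-refl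
  signed-sub (suc zero)    x y = sym (⁻¹-∙-comm x (- y))
  signed-sub (suc (suc m)) x y = signed-sub m x y

  sum-signed : ∀ {m} p (f : Fin m → Carrier) → sum (λ v → signed p (f v)) ≈ signed p (sum f)
  sum-signed zero          f = ≈-refl
  sum-signed (suc zero)    f = sum-neg f
  sum-signed (suc (suc p)) f = sum-signed p f

module Cones {c ℓ : Level} (k : Field c ℓ) {n : ℕ} where
  open Field k hiding (refl; zero)
  open Field k using () renaming (refl to ≈-refl)
  open Chains k {n}
  open SignedSums k {n}
  open import Relation.Binary.Reasoning.Setoid setoid

  Chain : Set c
  Chain = Subset n → Carrier

  below≡below′ : ∀ τ v → below τ v ≡ below′ τ v
  below≡below′ = countBelow-allFin

  below-∪⁅x⁆-< : ∀ σ x y → x ∉ σ → x < y → below (σ ∪ ⁅ x ⁆) y ≡ suc (below σ y)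
  below-∪⁅x⁆-< σ x y x∉σ x<y
    rewrite below≡below′ (σ ∪ ⁅ x ⁆) y | below≡below′ σ y = below′-∪⁅x⁆-< σ x y x∉σ x<y

  below-∪⁅x⁆-≮ : ∀ σ x y → ¬ x < y → below (σ ∪ ⁅ x ⁆) y ≡ below σ y
  below-∪⁅x⁆-≮ σ x y x≮y
    rewrite below≡below′ (σ ∪ ⁅ x ⁆) y | below≡below′ σ y = below′-∪⁅x⁆-≮ σ x y x≮y

  ∂-term : Chain → Subset n → Fin n → Carrier
  ∂-term z τ v = if does (v ∈? τ) then 0# else signed (below τ v) (z (τ ∪ ⁅ v ⁆))

  ∂≈sum : ∀ z τ → ∂ z τ ≈ sum (∂-term z τ)
  ∂≈sum z τ = reflexive (Σ-Fin≡sum (∂-term z τ))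

  ∂-term-∈ : ∀ z τ v → v ∈ τ → ∂-term z τ v ≈ 0#
  ∂-term-∈ z τ v v∈τ rewrite dec-true (v ∈? τ) v∈τ = ≈-refl

  ∂-term-∉ : ∀ z τ v → v ∉ τ → ∂-term z τ v ≈ signed (below τ v) (z (τ ∪ ⁅ v ⁆))
  ∂-term-∉ z τ v v∉τ rewrite dec-false (v ∈? τ) v∉τ = ≈-refl

  ∂-term-sub : ∀ y z τ v → ∂-term (λ σ → y σ - z σ) τ v ≈ ∂-term y τ v - ∂-term z τ v
  ∂-term-sub y z τ v with v ∈? τ
  ... | yes _ = sym (-‿inverseʳ 0#)
  ... | no  _ = signed-sub (below τ v) _ _

  ∂-sub : ∀ y z τ → ∂ (λ σ → y σ - z σ) τ ≈ ∂ y τ - ∂ z τ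
  ∂-sub y z τ = begin
    ∂ (λ σ → y σ - z σ) τ                       ≈⟨ ∂≈sum (λ σ → y σ - z σ) τ ⟩
    sum (∂-term (λ σ → y σ - z σ) τ)            ≈⟨ sum-cong-≋ (∂-term-sub y z τ) ⟩
    sum (λ v → ∂-term y τ v - ∂-term z τ v)     ≈⟨ sum-sub (∂-term y τ) (∂-term z τ) ⟩
    sum (∂-term y τ) - sum (∂-term z τ)         ≈⟨ +-cong (∂≈sum y τ) (-‿cong (∂≈sum z τ)) ⟨
    ∂ y τ - ∂ z τ                               ∎

  -- The cone with apex a; below σ a is the position of a in the ordered simplex σ.
  cone : Fin n → Chain → Chain
  cone a z σ = if does (a ∈? σ) then signed (below σ a) (z (σ ⊖ a)) else 0#

  cone-∈ : ∀ a z σ → a ∈ σ → cone a z σ ≈ signed (below σ a) (z (σ ⊖ a))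
  cone-∈ a z σ a∈σ rewrite dec-true (a ∈? σ) a∈σ = ≈-refl

  cone-∉ : ∀ a z σ → a ∉ σ → cone a z σ ≈ 0#
  cone-∉ a z σ a∉σ rewrite dec-false (a ∈? σ) a∉σ = ≈-refl

  ∂-cone-∉ : ∀ a z τ → a ∉ τ → ∂ (cone a z) τ ≈ z τ
  ∂-cone-∉ a z τ a∉τ = begin
    ∂ (cone a z) τ             ≈⟨ ∂≈sum (cone a z) τ ⟩
    sum (∂-term (cone a z) τ)  ≈⟨ sum-single (∂-term (cone a z) τ) a vanishes-off-a ⟩
    ∂-term (cone a z) τ a      ≈⟨ ∂-term-∉ (cone a z) τ a a∉τ ⟩
    signed A (cone a z (τ ∪ ⁅ a ⁆))
      ≈⟨ signed-cong A (cone-∈ a z (τ ∪ ⁅ a ⁆) (x∈p∪⁅x⁆ τ a)) ⟩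
    signed A (signed (below (τ ∪ ⁅ a ⁆) a) (z ((τ ∪ ⁅ a ⁆) ⊖ a)))
      ≡⟨ cong₂ (λ m σ → signed A (signed m (z σ))) (below-∪⁅x⁆-≮ τ a a (Finₚ.<-irrefl refl)) (p∪⁅x⁆⊖x≡p τ a a∉τ) ⟩
    signed A (signed A (z τ))  ≈⟨ signed-involutive A (z τ) ⟩
    z τ                        ∎
    where
    A : ℕ
    A = below τ a
    vanishes-off-a : ∀ v → v ≢ a → ∂-term (cone a z) τ v ≈ 0#
    vanishes-off-a v v≢a with v ∈? τ
    ... | yes _   = ≈-refl
    ... | no  v∉τ = trans (signed-cong (below τ v) (cone-∉ a z _ (x∉p∪⁅y⁆ τ v a∉τ (v≢a ∘ ≡.sym))))
                          (signed-0# (below τ v))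

  -- Inserting a and v in either order shifts exactly one of the two position counts by one.
  signed-below-swap : ∀ τ a v → a ∈ τ → v ∉ τ → ∀ x →
    signed (below τ v) (signed (below (τ ∪ ⁅ v ⁆) a) x) ≈ - signed (below τ a) (signed (below (τ ⊖ a) v) x)
  signed-below-swap τ a v a∈τ v∉τ x with <-cmp a v
  ... | tri< a<v _ v≮a = begin
    signed (below τ v) (signed (below (τ ∪ ⁅ v ⁆) a) x)
      ≡⟨ cong₂ (λ p q → signed p (signed q x)) below-τ-v (below-∪⁅x⁆-≮ τ v a v≮a) ⟩
    signed (suc B) (signed A x)  ≈⟨ signed-suc B (signed A x) ⟩
    - signed B (signed A x)      ≈⟨ -‿cong (signed-comm B A x) ⟩
    - signed A (signed B x)      ∎
    where
    A : ℕ
    A = below τ a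
    B : ℕ
    B = below (τ ⊖ a) v
    below-τ-v : below τ v ≡ suc B
    below-τ-v = ≡.trans (cong (λ σ → below σ v) (≡.sym (p⊖x∪⁅x⁆≡p τ a a∈τ)))
                        (below-∪⁅x⁆-< (τ ⊖ a) a v (x∉p⊖x τ a) a<v)
  ... | tri≈ _ refl _ = contradiction a∈τ v∉τ
  ... | tri> a≮v _ v<a = begin
    signed (below τ v) (signed (below (τ ∪ ⁅ v ⁆) a) x)
      ≡⟨ cong₂ (λ p q → signed p (signed q x)) below-τ-v (below-∪⁅x⁆-< τ v a v∉τ v<a) ⟩
    signed B (signed (suc A) x)  ≈⟨ signed-cong B (signed-suc A x) ⟩
    signed B (- signed A x)      ≈⟨ signed-neg B (signed A x) ⟩
    - signed B (signed A x)      ≈⟨ -‿cong (signed-comm B A x) ⟩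
    - signed A (signed B x)      ∎
    where
    A : ℕ
    A = below τ a
    B : ℕ
    B = below (τ ⊖ a) v
    below-τ-v : below τ v ≡ B
    below-τ-v = ≡.trans (cong (λ σ → below σ v) (≡.sym (p⊖x∪⁅x⁆≡p τ a a∈τ)))
                        (below-∪⁅x⁆-≮ (τ ⊖ a) a v a≮v)

  VanishesOn∋ : Fin n → Chain → Set ℓ
  VanishesOn∋ a z = ∀ σ → a ∈ σ → z σ ≈ 0#

  IsCycle : Chain → Set ℓ
  IsCycle z = ∀ τ → ∂ z τ ≈ 0#

  ∂-term-cone : ∀ a z τ → a ∈ τ → VanishesOn∋ a z → ∀ v →
                ∂-term (cone a z) τ v ≈ - signed (below τ a) (∂-term z (τ ⊖ a) v)
  ∂-term-cone a z τ a∈τ z∋a≈0 v with v ≟ a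
  ... | yes refl = begin
    ∂-term (cone a z) τ a                      ≈⟨ ∂-term-∈ (cone a z) τ a a∈τ ⟩
    0#                                         ≈⟨ -signed-0# (below τ a) ⟨
    - signed (below τ a) 0#                    ≈⟨ -‿cong (signed-cong (below τ a) term≈0) ⟨
    - signed (below τ a) (∂-term z (τ ⊖ a) a)  ∎
    where
    term≈0 : ∂-term z (τ ⊖ a) a ≈ 0#
    term≈0 = trans (∂-term-∉ z (τ ⊖ a) a (x∉p⊖x τ a))
                   (trans (signed-cong (below (τ ⊖ a) a) (z∋a≈0 _ (x∈p∪⁅x⁆ (τ ⊖ a) a))) (signed-0# (below (τ ⊖ a) a)))
  ... | no v≢a with v ∈? τ
  ...   | yes v∈τ = begin
    0#                                         ≈⟨ -signed-0# (below τ a) ⟨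
    - signed (below τ a) 0#                    ≈⟨ -‿cong (signed-cong (below τ a) (∂-term-∈ z (τ ⊖ a) v v∈τ⊖a)) ⟨
    - signed (below τ a) (∂-term z (τ ⊖ a) v)  ∎
    where v∈τ⊖a = x∈p∧x≢y⇒x∈p-y v∈τ v≢a
  ...   | no v∉τ = begin
    signed (below τ v) (cone a z (τ ∪ ⁅ v ⁆))
      ≈⟨ signed-cong (below τ v) (cone-∈ a z (τ ∪ ⁅ v ⁆) (x∈p∪q⁺ (inj₁ a∈τ))) ⟩
    signed (below τ v) (signed (below (τ ∪ ⁅ v ⁆) a) (z ((τ ∪ ⁅ v ⁆) ⊖ a)))
      ≡⟨ cong (λ σ → signed (below τ v) (signed (below (τ ∪ ⁅ v ⁆) a) (z σ))) (p∪⁅y⁆⊖x≡p⊖x∪⁅y⁆ τ v a v≢a) ⟩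
    signed (below τ v) (signed (below (τ ∪ ⁅ v ⁆) a) (z ((τ ⊖ a) ∪ ⁅ v ⁆)))
      ≈⟨ signed-below-swap τ a v a∈τ v∉τ _ ⟩
    - signed (below τ a) (signed (below (τ ⊖ a) v) (z ((τ ⊖ a) ∪ ⁅ v ⁆)))
      ≈⟨ -‿cong (signed-cong (below τ a) (∂-term-∉ z (τ ⊖ a) v (v∉τ ∘ p─q⊆p τ ⁅ a ⁆))) ⟨
    - signed (below τ a) (∂-term z (τ ⊖ a) v) ∎

  ∂-cone-∈ : ∀ a z τ → a ∈ τ → VanishesOn∋ a z → IsCycle z → ∂ (cone a z) τ ≈ 0#
  ∂-cone-∈ a z τ a∈τ z∋a≈0 ∂z≈0 = begin
    ∂ (cone a z) τ                                 ≈⟨ ∂≈sum (cone a z) τ ⟩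
    sum (∂-term (cone a z) τ)                      ≈⟨ sum-cong-≋ (∂-term-cone a z τ a∈τ z∋a≈0) ⟩
    sum (λ v → - signed A (∂-term z (τ ⊖ a) v))    ≈⟨ sum-neg (λ v → signed A (∂-term z (τ ⊖ a) v)) ⟩
    - sum (λ v → signed A (∂-term z (τ ⊖ a) v))    ≈⟨ -‿cong (sum-signed A (∂-term z (τ ⊖ a))) ⟩
    - signed A (sum (∂-term z (τ ⊖ a)))            ≈⟨ -‿cong (signed-cong A (∂≈sum z (τ ⊖ a))) ⟨
    - signed A (∂ z (τ ⊖ a))                       ≈⟨ -‿cong (signed-cong A (∂z≈0 (τ ⊖ a))) ⟩
    - signed A 0#                                  ≈⟨ -signed-0# A ⟩
    0#                                             ∎
    where
    A : ℕ
    A = below τ a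

  ∂-cone : ∀ a z → VanishesOn∋ a z → IsCycle z → ∀ τ → ∂ (cone a z) τ ≈ z τ
  ∂-cone a z z∋a≈0 ∂z≈0 τ with a ∈? τ
  ... | yes a∈τ = trans (∂-cone-∈ a z τ a∈τ z∋a≈0 ∂z≈0) (sym (z∋a≈0 τ a∈τ))
  ... | no  a∉τ = ∂-cone-∉ a z τ a∉τ

  suspension : Fin n → Fin n → Chain → Chain
  suspension a b z σ = cone a z σ - cone b z σ

  suspension-isCycle : ∀ a b z → VanishesOn∋ a z → VanishesOn∋ b z → IsCycle z →
                       IsCycle (suspension a b z)
  suspension-isCycle a b z z∋a≈0 z∋b≈0 ∂z≈0 τ = begin
    ∂ (suspension a b z) τ           ≈⟨ ∂-sub (cone a z) (cone b z) τ ⟩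
    ∂ (cone a z) τ - ∂ (cone b z) τ  ≈⟨ +-cong (∂-cone a z z∋a≈0 ∂z≈0 τ) (-‿cong (∂-cone b z z∋b≈0 ∂z≈0 τ)) ⟩
    z τ - z τ                        ≈⟨ -‿inverseʳ (z τ) ⟩
    0#                               ∎

module Witnesses {c ℓ : Level} (k : Field c ℓ) {n : ℕ} (G : Graph n) where
  open Field k hiding (refl; zero)
  open Field k using () renaming (refl to ≈-refl)
  open Graph G renaming (sym to adj-sym)
  open Chains k {n}
  open SignedSums k {n}
  open Cones k {n}
  open import Algebra.Properties.AbelianGroup +-abelianGroup using (ε⁻¹≈ε)
  open import Relation.Binary.Reasoning.Setoid setoid

  -- Certifies H̃_{s-1}(Ind(G[W])) ≠ 0 for some W ⊆ U with ∣ W ∣ = m.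
  record HomologyWitness (U : Fin n → Bool) (s m : ℕ) : Set (c ⊔ ℓ) where
    field
      W          : Subset n
      W⊆U        : ∀ {w} → w ∈ W → U w ≡ true
      ∣W∣≡m      : ∣ W ∣ ≡ m
      z          : Chain
      z-isChain  : IsChain G W s z
      z-isCycle  : IsCycle z
      τ₀         : Subset n
      τ₀⊆W       : τ₀ ⊆ W
      z[τ₀]≉0    : ¬ z τ₀ ≈ 0#
      τ₀-dominates : ∀ w → w ∈ W → w ∉ τ₀ → ∃ λ u → u ∈ τ₀ × adj w u ≡ true

  witness⇒¬vanishes : ∀ {U s m} (w : HomologyWitness U s m) →
                      ¬ ReducedHomologyVanishes G (HomologyWitness.W w) s
  witness⇒¬vanishes {s = s} w vanishes = not-a-boundary (vanishes z z-isChain z-isCycle)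
    where
    open HomologyWitness w
    not-a-face : ∀ v → v ∉ τ₀ → ¬ FaceOfSize G W (suc s) (τ₀ ∪ ⁅ v ⁆)
    not-a-face v v∉τ₀ (τ₀∪v⊆W , independent , _)
      with τ₀-dominates v (τ₀∪v⊆W (x∈p∪⁅x⁆ τ₀ v)) v∉τ₀
    ... | u , u∈τ₀ , v~u
      with ≡.trans (≡.sym v~u) (independent v u (x∈p∪⁅x⁆ τ₀ v) (x∈p∪q⁺ (inj₁ u∈τ₀)))
    ... | ()
    ∂-term≈0 : ∀ {d} → IsChain G W (suc s) d → ∀ v → ∂-term d τ₀ v ≈ 0#
    ∂-term≈0 {d} d-isChain v with v ∈? τ₀
    ... | yes _    = ≈-refl
    ... | no  v∉τ₀ = trans (signed-cong (below τ₀ v) (d-isChain _ (not-a-face v v∉τ₀))) (signed-0# (below τ₀ v))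
    not-a-boundary : ¬ Σ Chain λ d → IsChain G W (suc s) d × (∀ σ → ∂ d σ ≈ z σ)
    not-a-boundary (d , d-isChain , ∂d≈z) = z[τ₀]≉0 (begin
      z τ₀               ≈⟨ ∂d≈z τ₀ ⟨
      ∂ d τ₀             ≈⟨ ∂≈sum d τ₀ ⟩
      sum (∂-term d τ₀)  ≈⟨ sum-zero (∂-term d τ₀) (∂-term≈0 d-isChain) ⟩
      0#                 ∎)

  -- The generator in degree -1 of the augmented chain complex.
  emptyFace : Chain
  emptyFace σ = if does (nonempty? σ) then 0# else 1#

  emptyFace-nonempty : ∀ σ → Nonempty σ → emptyFace σ ≈ 0#
  emptyFace-nonempty σ σ≠∅ rewrite dec-true (nonempty? σ) σ≠∅ = ≈-refl

  emptyFace-⊥ : emptyFace ⊥ ≈ 1#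
  emptyFace-⊥ rewrite dec-false (nonempty? {n} ⊥) (λ (_ , x∈⊥) → ∉⊥ x∈⊥) = ≈-refl

  emptyFaceWitness : ∀ U → HomologyWitness U 0 0
  emptyFaceWitness U = record
    { W            = ⊥
    ; W⊆U          = λ x∈⊥ → contradiction x∈⊥ ∉⊥
    ; ∣W∣≡m        = ∣⊥∣≡0 n
    ; z            = emptyFace
    ; z-isChain    = isChain
    ; z-isCycle    = λ τ → trans (∂≈sum emptyFace τ) (sum-zero (∂-term emptyFace τ) (∂-term≈0 τ))
    ; τ₀           = ⊥
    ; τ₀⊆W         = id
    ; z[τ₀]≉0      = λ 1≈0 → 1≉0 (trans (sym emptyFace-⊥) 1≈0)
    ; τ₀-dominates = λ _ w∈⊥ → contradiction w∈⊥ ∉⊥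
    }
    where
    isChain : IsChain G ⊥ 0 emptyFace
    isChain σ not-a-face with nonempty? σ
    ... | yes _   = ≈-refl
    ... | no  σ=∅ = ⊥-elim (not-a-face (⊆⊥ , independent , ∣σ∣≡0))
      where
      ⊆⊥ : σ ⊆ ⊥
      ⊆⊥ {x} x∈σ = contradiction (x , x∈σ) σ=∅
      independent : Independent G σ
      independent u _ u∈σ _ = contradiction (u , u∈σ) σ=∅
      ∣σ∣≡0 : ∣ σ ∣ ≡ 0
      ∣σ∣≡0 = ≡.trans (cong ∣_∣ (Empty-unique σ=∅)) (∣⊥∣≡0 n)
    ∂-term≈0 : ∀ τ v → ∂-term emptyFace τ v ≈ 0#
    ∂-term≈0 τ v with v ∈? τ
    ... | yes _ = ≈-refl
    ... | no  _ = trans (signed-cong (below τ v) (emptyFace-nonempty _ (v , x∈p∪⁅x⁆ τ v))) (signed-0# (below τ v))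

  cone-isChain : ∀ {W W⁺ s z} x → IsChain G W s z → W ⊆ W⁺ → x ∈ W⁺ →
                 (∀ {w} → w ∈ W → adj x w ≡ false) → IsChain G W⁺ (suc s) (cone x z)
  cone-isChain {W} {W⁺} {s} {z} x z-isChain W⊆W⁺ x∈W⁺ x≁W σ not-a-face with x ∈? σ
  ... | no  _   = ≈-refl
  ... | yes x∈σ = trans (signed-cong (below σ x) (z-isChain (σ ⊖ x) not-a-face′)) (signed-0# (below σ x))
    where
    split : ∀ {u} → u ∈ σ → u ≡ x ⊎ u ∈ σ ⊖ x
    split {u} u∈σ with u ≟ x
    ... | yes u≡x = inj₁ u≡x
    ... | no  u≢x = inj₂ (x∈p∧x≢y⇒x∈p-y u∈σ u≢x)
    not-a-face′ : ¬ FaceOfSize G W s (σ ⊖ x)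
    not-a-face′ (σ⊖x⊆W , independent , ∣σ⊖x∣≡s) =
      not-a-face (σ⊆W⁺ , independent⁺ , ≡.trans (∣p∣≡1+∣p⊖x∣ σ x x∈σ) (cong suc ∣σ⊖x∣≡s))
      where
      σ⊆W⁺ : σ ⊆ W⁺
      σ⊆W⁺ u∈σ with split u∈σ
      ... | inj₁ refl = x∈W⁺
      ... | inj₂ u∈σ⊖x = W⊆W⁺ (σ⊖x⊆W u∈σ⊖x)
      independent⁺ : Independent G σ
      independent⁺ u v u∈σ v∈σ with split u∈σ | split v∈σ
      ... | inj₁ refl   | inj₁ refl   = irref u
      ... | inj₁ refl   | inj₂ v∈σ⊖x  = x≁W (σ⊖x⊆W v∈σ⊖x)
      ... | inj₂ u∈σ⊖x  | inj₁ refl   = ≡.trans (adj-sym u v) (x≁W (σ⊖x⊆W u∈σ⊖x))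
      ... | inj₂ u∈σ⊖x  | inj₂ v∈σ⊖x = independent u v u∈σ⊖x v∈σ⊖x

  module _ {U′ U : Fin n → Bool} {s m l : ℕ} (w : HomologyWitness U′ s m) (a b : Fin n) (L : Subset n)
           (∣L∣≡l : ∣ L ∣ ≡ l) (b∈L : b ∈ L) (L⊆N[a] : ∀ {x} → x ∈ L → adj a x ≡ true)
           (a∉W : a ∉ HomologyWitness.W w)
           (a≁W : ∀ {x} → x ∈ HomologyWitness.W w → adj a x ≡ false)
           (b≁W : ∀ {x} → x ∈ HomologyWitness.W w → adj b x ≡ false)
           (U′⊆U : ∀ {x} → U′ x ≡ true → U x ≡ true) (a∈U : U a ≡ true)
           (L⊆U : ∀ {x} → x ∈ L → U x ≡ true) where
    open HomologyWitness w

    private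
      aL : Subset n
      aL = ⁅ a ⁆ ∪ L

      W⁺ : Subset n
      W⁺ = aL ∪ W

      τ₀⁺ : Subset n
      τ₀⁺ = τ₀ ∪ ⁅ a ⁆

      W⊆W⁺ : W ⊆ W⁺
      W⊆W⁺ x∈W = x∈p∪q⁺ (inj₂ x∈W)

      a∈W⁺ : a ∈ W⁺
      a∈W⁺ = x∈p∪q⁺ (inj₁ (x∈p∪q⁺ (inj₁ (x∈⁅x⁆ a))))

      L⊆W⁺ : L ⊆ W⁺
      L⊆W⁺ x∈L = x∈p∪q⁺ (inj₁ (x∈p∪q⁺ (inj₂ x∈L)))

      L∩W=∅ : ∀ {x} → x ∈ L → x ∉ W
      L∩W=∅ x∈L x∈W with ≡.trans (≡.sym (L⊆N[a] x∈L)) (a≁W x∈W)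
      ... | ()

      a∉L : a ∉ L
      a∉L a∈L with ≡.trans (≡.sym (L⊆N[a] a∈L)) (irref a)
      ... | ()

      a≢b : a ≢ b
      a≢b refl = a∉L b∈L

      vanishes∋ : ∀ {x} → x ∉ W → VanishesOn∋ x z
      vanishes∋ x∉W σ x∈σ = z-isChain σ λ (σ⊆W , _) → x∉W (σ⊆W x∈σ)

      W⁺⊆U : ∀ {x} → x ∈ W⁺ → U x ≡ true
      W⁺⊆U x∈W⁺ with x∈p∪q⁻ aL W x∈W⁺
      ... | inj₂ x∈W = U′⊆U (W⊆U x∈W)
      ... | inj₁ x∈aL with x∈p∪q⁻ ⁅ a ⁆ L x∈aL
      ...   | inj₁ x∈⁅a⁆ = subst-∈⁅⁆ (λ y → U y ≡ true) a∈U x∈⁅a⁆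
      ...   | inj₂ x∈L   = L⊆U x∈L

      ∣W⁺∣≡1+l+m : ∣ W⁺ ∣ ≡ suc (l ℕ.+ m)
      ∣W⁺∣≡1+l+m = ≡.trans (∣p∪q∣≡∣p∣+∣q∣ aL W aL∩W=∅)
        (cong₂ ℕ._+_ (≡.trans (∣p∪q∣≡∣p∣+∣q∣ ⁅ a ⁆ L a∩L=∅) (cong₂ ℕ._+_ (∣⁅x⁆∣≡1 a) ∣L∣≡l)) ∣W∣≡m)
        where
        a∩L=∅ : ∀ {x} → x ∈ ⁅ a ⁆ → x ∉ L
        a∩L=∅ x∈⁅a⁆ = subst-∈⁅⁆ (_∉ L) a∉L x∈⁅a⁆
        aL∩W=∅ : ∀ {x} → x ∈ aL → x ∉ W
        aL∩W=∅ x∈aL with x∈p∪q⁻ ⁅ a ⁆ L x∈aL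
        ... | inj₁ x∈⁅a⁆ = subst-∈⁅⁆ (_∉ W) a∉W x∈⁅a⁆
        ... | inj₂ x∈L   = L∩W=∅ x∈L

      τ₀⁺⊆W⁺ : τ₀⁺ ⊆ W⁺
      τ₀⁺⊆W⁺ x∈τ₀⁺ with x∈p∪q⁻ τ₀ ⁅ a ⁆ x∈τ₀⁺
      ... | inj₁ x∈τ₀  = W⊆W⁺ (τ₀⊆W x∈τ₀)
      ... | inj₂ x∈⁅a⁆ = subst-∈⁅⁆ (_∈ W⁺) a∈W⁺ x∈⁅a⁆

      suspension[τ₀⁺] : suspension a b z τ₀⁺ ≈ signed (below τ₀⁺ a) (z τ₀)
      suspension[τ₀⁺] = begin
        cone a z τ₀⁺ - cone b z τ₀⁺
          ≈⟨ +-cong (cone-∈ a z τ₀⁺ (x∈p∪⁅x⁆ τ₀ a)) (-‿cong (cone-∉ b z τ₀⁺ b∉τ₀⁺)) ⟩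
        signed (below τ₀⁺ a) (z (τ₀⁺ ⊖ a)) - 0#   ≈⟨ +-congˡ ε⁻¹≈ε ⟩
        signed (below τ₀⁺ a) (z (τ₀⁺ ⊖ a)) + 0#   ≈⟨ +-identityʳ _ ⟩
        signed (below τ₀⁺ a) (z (τ₀⁺ ⊖ a))        ≡⟨ cong (signed (below τ₀⁺ a) ∘ z) (p∪⁅x⁆⊖x≡p τ₀ a (a∉W ∘ τ₀⊆W)) ⟩
        signed (below τ₀⁺ a) (z τ₀)               ∎
        where
        b∉τ₀⁺ : b ∉ τ₀⁺
        b∉τ₀⁺ = x∉p∪⁅y⁆ τ₀ a (L∩W=∅ b∈L ∘ τ₀⊆W) (a≢b ∘ ≡.sym)

      τ₀⁺-dominates : ∀ x → x ∈ W⁺ → x ∉ τ₀⁺ → ∃ λ u → u ∈ τ₀⁺ × adj x u ≡ true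
      τ₀⁺-dominates x x∈W⁺ x∉τ₀⁺ with x∈p∪q⁻ aL W x∈W⁺
      ... | inj₂ x∈W with τ₀-dominates x x∈W (x∉τ₀⁺ ∘ x∈p∪q⁺ ∘ inj₁)
      ...   | u , u∈τ₀ , x~u = u , x∈p∪q⁺ (inj₁ u∈τ₀) , x~u
      τ₀⁺-dominates x x∈W⁺ x∉τ₀⁺ | inj₁ x∈aL with x∈p∪q⁻ ⁅ a ⁆ L x∈aL
      ... | inj₁ x∈⁅a⁆ = contradiction (x∈p∪q⁺ (inj₂ x∈⁅a⁆)) x∉τ₀⁺
      ... | inj₂ x∈L   = a , x∈p∪⁅x⁆ τ₀ a , ≡.trans (adj-sym x a) (L⊆N[a] x∈L)

    extendWitness : HomologyWitness U (suc s) (suc (l ℕ.+ m))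
    extendWitness = record
      { W            = W⁺
      ; W⊆U          = W⁺⊆U
      ; ∣W∣≡m        = ∣W⁺∣≡1+l+m
      ; z            = suspension a b z
      ; z-isChain    = λ σ not-a-face → begin
          cone a z σ - cone b z σ ≈⟨ +-cong (cone-isChain a z-isChain W⊆W⁺ a∈W⁺ a≁W σ not-a-face)
                                            (-‿cong (cone-isChain b z-isChain W⊆W⁺ (L⊆W⁺ b∈L) b≁W σ not-a-face)) ⟩
          0# - 0#                 ≈⟨ -‿inverseʳ 0# ⟩
          0#                      ∎
      ; z-isCycle    = suspension-isCycle a b z (vanishes∋ a∉W) (vanishes∋ (L∩W=∅ b∈L)) z-isCycle
      ; τ₀           = τ₀⁺
      ; τ₀⊆W         = τ₀⁺⊆W⁺
      ; z[τ₀]≉0      = λ z⁺[τ₀⁺]≈0 → z[τ₀]≉0 (signed-≈0# (below τ₀⁺ a) (trans (sym suspension[τ₀⁺]) z⁺[τ₀⁺]≈0))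
      ; τ₀-dominates = τ₀⁺-dominates
      }

∧≡true⁻ : ∀ {a b} → a ∧ b ≡ true → a ≡ true × b ≡ true
∧≡true⁻ {true} {true} refl = refl , refl

∧≡true⁺ : ∀ {a b} → a ≡ true → b ≡ true → a ∧ b ≡ true
∧≡true⁺ refl refl = refl

∧-not≡false⇒≡true : ∀ {a b} → a ≡ true → a ∧ not b ≡ false → b ≡ true
∧-not≡false⇒≡true {b = true} refl refl = refl

∈-tabulate⁺ : ∀ {n} (f : Fin n → Bool) {x} → f x ≡ true → x ∈ Vec.tabulate f
∈-tabulate⁺ f {x} fx≡true = Vecₚ.lookup⇒[]= x (Vec.tabulate f) (≡.trans (Vecₚ.lookup∘tabulate f x) fx≡true)

∈-tabulate⁻ : ∀ {n} (f : Fin n → Bool) {x} → x ∈ Vec.tabulate f → f x ≡ true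
∈-tabulate⁻ f {x} x∈ = ≡.trans (≡.sym (Vecₚ.lookup∘tabulate f x)) (Vecₚ.[]=⇒lookup x∈)

image : ∀ {n m} → (Fin n → Fin m) → Subset n → Subset m
image {zero}  f []          = ⊥
image {suc n} f (true  ∷ p) = ⁅ f zero ⁆ ∪ image (f ∘ suc) p
image {suc n} f (false ∷ p) = image (f ∘ suc) p

∈-image : ∀ {n m} (f : Fin n → Fin m) p {x} → x ∈ p → f x ∈ image f p
∈-image f (true  ∷ p) here       = x∈p∪q⁺ (inj₁ (x∈⁅x⁆ (f zero)))
∈-image f (true  ∷ p) (there x∈) = x∈p∪q⁺ (inj₂ (∈-image (f ∘ suc) p x∈))
∈-image f (false ∷ p) (there x∈) = ∈-image (f ∘ suc) p x∈

∣image∣≤ : ∀ {n m} (f : Fin n → Fin m) p → ∣ image f p ∣ ≤ ∣ p ∣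
∣image∣≤ {zero} {m} f []    = ℕₚ.≤-reflexive (∣⊥∣≡0 m)
∣image∣≤ f (true  ∷ p) = begin
  ∣ ⁅ f zero ⁆ ∪ image (f ∘ suc) p ∣        ≤⟨ ∣p∪q∣≤∣p∣+∣q∣ ⁅ f zero ⁆ _ ⟩
  ∣ ⁅ f zero ⁆ ∣ ℕ.+ ∣ image (f ∘ suc) p ∣  ≡⟨ cong (ℕ._+ ∣ image (f ∘ suc) p ∣) (∣⁅x⁆∣≡1 (f zero)) ⟩
  suc ∣ image (f ∘ suc) p ∣                ≤⟨ s≤s (∣image∣≤ (f ∘ suc) p) ⟩
  suc ∣ p ∣                                ∎
  where open ℕₚ.≤-Reasoning
∣image∣≤ f (false ∷ p) = ∣image∣≤ (f ∘ suc) p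

∣p∣<m⇒∃∉ : ∀ {m} (p : Subset m) → ∣ p ∣ ℕ.< m → ∃ λ x → x ∉ p
∣p∣<m⇒∃∉ {m} p ∣p∣<m with Finₚ.any? (λ x → ¬? (x ∈? p))
... | yes x∉p = x∉p
... | no  ∄x∉p = contradiction (p⊆q⇒∣p∣≤∣q∣ ⊤⊆p) (ℕₚ.<⇒≱ (≡.subst (∣ p ∣ ℕ.<_) (≡.sym (∣⊤∣≡n m)) ∣p∣<m))
  where
  ⊤⊆p : ⊤ ⊆ p
  ⊤⊆p {x} _ = decidable-stable (x ∈? p) (λ x∉p → ∄x∉p (x , x∉p))

∃-colour-unused : ∀ {n m} (col : Fin n → Fin m) (F : Subset n) → ∣ F ∣ ℕ.< m →
                  ∃ λ c → ∀ {w} → w ∈ F → col w ≢ c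
∃-colour-unused col F ∣F∣<m with ∣p∣<m⇒∃∉ (image col F) (ℕₚ.≤-<-trans (∣image∣≤ col F) ∣F∣<m)
... | c , c∉image = c , λ w∈F col[w]≡c → c∉image (≡.subst (_∈ image col F) col[w]≡c (∈-image col F w∈F))

module Colourings {n : ℕ} (G : Graph n) where
  open Graph G renaming (sym to adj-sym)

  ColouringOn : (Fin n → Set) → ℕ → Set
  ColouringOn Q m = Σ (Fin n → Fin m) λ col → ∀ u v → Q u → Q v → adj u v ≡ true → col u ≢ col v

  ColouringOf : (Fin n → Bool) → ℕ → Set
  ColouringOf U = ColouringOn (λ w → U w ≡ true)

  neighboursIn : (Fin n → Bool) → Fin n → Subset n
  neighboursIn U v = Vec.tabulate (λ w → U w ∧ adj v w)

  module _ (U : Fin n → Bool) {r : ℕ} (deg≤r : ∀ v → U v ≡ true → ∣ neighboursIn U v ∣ ≤ r) where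

    InPrefix : ℕ → Fin n → Set
    InPrefix i w = U w ≡ true × toℕ w ℕ.< i

    greedy : ∀ i → i ≤ n → ColouringOn (InPrefix i) (suc r)
    greedy zero    _   = (λ _ → zero) , λ { _ _ (_ , ()) }
    greedy (suc i) i<n = extend (U v) refl (greedy i (ℕₚ.<⇒≤ i<n))
      where
      v : Fin n
      v = Fin.fromℕ< i<n

      toℕv≡i : toℕ v ≡ i
      toℕv≡i = Finₚ.toℕ-fromℕ< i<n

      split : ∀ {w} → InPrefix (suc i) w → InPrefix i w ⊎ w ≡ v
      split (U[w] , w<1+i) with ℕₚ.m<1+n⇒m<n∨m≡n w<1+i
      ... | inj₁ w<i  = inj₁ (U[w] , w<i)
      ... | inj₂ w≡i = inj₂ (Finₚ.toℕ-injective (≡.trans w≡i (≡.sym toℕv≡i)))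

      ≢v : ∀ {w} → InPrefix i w → w ≢ v
      ≢v (_ , w<i) refl = ℕₚ.<-irrefl toℕv≡i w<i

      extend : ∀ b → U v ≡ b → ColouringOn (InPrefix i) (suc r) → ColouringOn (InPrefix (suc i)) (suc r)
      extend false U[v]≡false (col , proper) = col , proper′
        where
        ∉U : ∀ {w} → InPrefix (suc i) w → InPrefix i w
        ∉U w∈ with split w∈
        ... | inj₁ w∈′ = w∈′
        ... | inj₂ refl with ≡.trans (≡.sym (proj₁ w∈)) U[v]≡false
        ...   | ()
        proper′ : ∀ u w → InPrefix (suc i) u → InPrefix (suc i) w → adj u w ≡ true → col u ≢ col w
        proper′ u w u∈ w∈ = proper u w (∉U u∈) (∉U w∈)
      extend true U[v]≡true (col , proper) = col′ , proper′
        where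
        earlier : Subset n
        earlier = Vec.tabulate λ w → (U w ∧ adj v w) ∧ does (toℕ w ℕ.<? i)

        earlier⊆N[v] : earlier ⊆ neighboursIn U v
        earlier⊆N[v] {w} w∈ = ∈-tabulate⁺ _ (proj₁ (∧≡true⁻ (∈-tabulate⁻ _ w∈)))

        unused : ∃ λ c → ∀ {w} → w ∈ earlier → col w ≢ c
        unused = ∃-colour-unused col earlier (s≤s (ℕₚ.≤-trans (p⊆q⇒∣p∣≤∣q∣ earlier⊆N[v]) (deg≤r v U[v]≡true)))

        c : Fin (suc r)
        c = proj₁ unused

        ∈earlier : ∀ {w} → InPrefix i w → adj v w ≡ true → w ∈ earlier
        ∈earlier (U[w] , w<i) v~w = ∈-tabulate⁺ _ (∧≡true⁺ (∧≡true⁺ U[w] v~w) (dec-true (_ ℕ.<? i) w<i))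

        col′ : Fin n → Fin (suc r)
        col′ w = if does (w ≟ v) then c else col w

        col′[v] : col′ v ≡ c
        col′[v] rewrite dec-true (v ≟ v) refl = refl

        col′[w] : ∀ {w} → InPrefix i w → col′ w ≡ col w
        col′[w] {w} w∈ rewrite dec-false (w ≟ v) (≢v w∈) = refl

        proper′ : ∀ u w → InPrefix (suc i) u → InPrefix (suc i) w → adj u w ≡ true → col′ u ≢ col′ w
        proper′ u w u∈ w∈ u~w with split u∈ | split w∈
        ... | inj₁ u∈′ | inj₁ w∈′ = λ eq →
          proper u w u∈′ w∈′ u~w (≡.trans (≡.sym (col′[w] u∈′)) (≡.trans eq (col′[w] w∈′)))
        ... | inj₂ refl | inj₁ w∈′ = λ eq →
          proj₂ unused (∈earlier w∈′ u~w) (≡.sym (≡.trans (≡.sym col′[v]) (≡.trans eq (col′[w] w∈′))))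
        ... | inj₁ u∈′ | inj₂ refl = λ eq →
          proj₂ unused (∈earlier u∈′ (≡.trans (adj-sym w u) u~w)) (≡.trans (≡.sym (col′[w] u∈′)) (≡.trans eq col′[v]))
        ... | inj₂ refl | inj₂ refl with ≡.trans (≡.sym u~w) (irref u)
        ...   | ()

    greedyColouring : ColouringOf U (suc r)
    greedyColouring with greedy n ℕₚ.≤-refl
    ... | col , proper = col , λ u w U[u] U[w] → proper u w (U[u] , Finₚ.toℕ<n u) (U[w] , Finₚ.toℕ<n w)

  constantColouring : ∀ {U m} → (∀ u w → U u ≡ true → U w ≡ true → adj u w ≢ true) → ColouringOf U (suc m)
  constantColouring no-edge = (λ _ → zero) , λ u w U[u] U[w] u~w _ → no-edge u w U[u] U[w] u~w

  nonNeighbours : (Fin n → Bool) → Fin n → Fin n → Fin n → Bool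
  nonNeighbours U u v w = U w ∧ not (adj u w ∨ adj v w)

  nonNeighbours⁻ : ∀ U u v {w} → nonNeighbours U u v w ≡ true → U w ≡ true × adj u w ≡ false × adj v w ≡ false
  nonNeighbours⁻ U u v {w} eq with U w | adj u w | adj v w
  nonNeighbours⁻ U u v refl | true | false | false = refl , refl , refl

  -- Kept vertices get colours ≥ 2, N(u) gets 0 and the rest of N(v) gets 1.
  paint : ∀ {m} → Bool → Bool → Fin m → Fin (suc (suc m))
  paint true  _     c = suc (suc c)
  paint false true  _ = zero
  paint false false _ = suc zero

  extendColouring : TriangleFree G → ∀ U {u v m} → adj u v ≡ true →
                    ColouringOf (nonNeighbours U u v) m → ColouringOf U (suc (suc m))
  extendColouring triangleFree U {u} {v} u~v (col , proper) = col′ , proper′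
    where
    col′ : Fin n → Fin _
    col′ w = paint (nonNeighbours U u v w) (adj u w) (col w)

    proper′ : ∀ w₁ w₂ → U w₁ ≡ true → U w₂ ≡ true → adj w₁ w₂ ≡ true → col′ w₁ ≢ col′ w₂
    proper′ w₁ w₂ U[w₁] U[w₂] w₁~w₂
      with nonNeighbours U u v w₁ in e₁ | nonNeighbours U u v w₂ in e₂
    ... | true  | true  = proper w₁ w₂ e₁ e₂ w₁~w₂ ∘ Finₚ.suc-injective ∘ Finₚ.suc-injective
    ... | true  | false with adj u w₂
    ...   | true  = λ ()
    ...   | false = λ ()
    proper′ w₁ w₂ U[w₁] U[w₂] w₁~w₂ | false | true with adj u w₁
    ...   | true  = λ ()
    ...   | false = λ ()
    proper′ w₁ w₂ U[w₁] U[w₂] w₁~w₂ | false | false with adj u w₁ in a₁ | adj u w₂ in a₂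
    ...   | true  | true  = λ _ → triangleFree u w₁ w₂ a₁ w₁~w₂ a₂
    ...   | true  | false = λ ()
    ...   | false | true  = λ ()
    ...   | false | false =
      λ _ → triangleFree v w₁ w₂ (∧-not≡false⇒≡true U[w₁] e₁) w₁~w₂ (∧-not≡false⇒≡true U[w₂] e₂)

module ColourOrWitness {c ℓ : Level} (k : Field c ℓ) {n : ℕ} (G : Graph n) (triangleFree : TriangleFree G)
                       (r : ℕ) where
  open Graph G renaming (sym to adj-sym)
  open Colourings G
  open Witnesses k G

  colourBound : ℕ → ℕ
  colourBound zero    = suc r
  colourBound (suc t) = suc (suc (colourBound t))

  suc-colourBound : ∀ t → suc (colourBound t) ≡ t ℕ.+ r ℕ.+ suc (suc t)
  suc-colourBound zero    = ≡.sym (ℕₚ.+-comm r 2)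
  suc-colourBound (suc t) =
    cong suc (≡.trans (cong suc (suc-colourBound t)) (≡.sym (ℕₚ.+-suc (t ℕ.+ r) (suc (suc t)))))

  -- Ind of the star on a and r + 1 of its neighbours is disconnected: {a} − {b} is a 0-cycle.
  starWitness : ∀ U a → U a ≡ true → suc r ≤ ∣ neighboursIn U a ∣ → HomologyWitness U 1 (suc (suc r))
  starWitness U a U[a] r<deg with ∃-⊆-of-size (neighboursIn U a) (suc r) r<deg
  ... | L , L⊆N[a] , ∣L∣≡1+r with 0<∣p∣⇒Nonempty L (≡.subst (0 ℕ.<_) (≡.sym ∣L∣≡1+r) (s≤s z≤n))
  ... | b , b∈L = ≡.subst (HomologyWitness U 1) (cong suc (ℕₚ.+-identityʳ (suc r)))
    (extendWitness (emptyFaceWitness U) a b L ∣L∣≡1+r b∈L (proj₂ ∘ ∧≡true⁻ ∘ in-N[a]) ∉⊥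
                   (λ x∈⊥ → contradiction x∈⊥ ∉⊥) (λ x∈⊥ → contradiction x∈⊥ ∉⊥) id U[a] (proj₁ ∘ ∧≡true⁻ ∘ in-N[a]))
    where
    in-N[a] : ∀ {x} → x ∈ L → U x ∧ adj a x ≡ true
    in-N[a] x∈L = ∈-tabulate⁻ _ (L⊆N[a] x∈L)

  colourOrWitness : ∀ t U → ColouringOf U (colourBound t) ⊎ HomologyWitness U (suc t) (suc (colourBound t))
  colourOrWitness zero U with Finₚ.any? (λ a → (U a Boolₚ.≟ true) ×-dec (suc r ℕ.≤? ∣ neighboursIn U a ∣))
  ... | yes (a , U[a] , r<deg) = inj₂ (starWitness U a U[a] r<deg)
  ... | no  ∄a = inj₁ (greedyColouring U λ a U[a] → ℕₚ.≤-pred (ℕₚ.≰⇒> λ r<deg → ∄a (a , U[a] , r<deg)))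
  colourOrWitness (suc t) U
    with Finₚ.any? (λ u → Finₚ.any? λ v → (U u Boolₚ.≟ true) ×-dec (U v Boolₚ.≟ true) ×-dec (adj u v Boolₚ.≟ true))
  ... | no  ∄uv = inj₁ (constantColouring λ u v U[u] U[v] u~v → ∄uv (u , v , U[u] , U[v] , u~v))
  ... | yes (u , v , U[u] , U[v] , u~v) with colourOrWitness t (nonNeighbours U u v)
  ...   | inj₁ colouring = inj₁ (extendColouring triangleFree U u~v colouring)
  ...   | inj₂ w = inj₂ (extendWitness w u v ⁅ v ⁆ (∣⁅x⁆∣≡1 v) (x∈⁅x⁆ v) (subst-∈⁅⁆ (λ y → adj u y ≡ true) u~v) u∉W
                           (proj₁ ∘ proj₂ ∘ nonNeighbours⁻ U u v ∘ W⊆U)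
                           (proj₂ ∘ proj₂ ∘ nonNeighbours⁻ U u v ∘ W⊆U)
                           (proj₁ ∘ nonNeighbours⁻ U u v) U[u] (subst-∈⁅⁆ (λ y → U y ≡ true) U[v]))
    where
    open HomologyWitness w using (W; W⊆U)
    u∉W : u ∉ W
    u∉W u∈W with ≡.trans (≡.sym (proj₂ (proj₂ (nonNeighbours⁻ U u v (W⊆U u∈W))))) (≡.trans (adj-sym v u) u~v)
    ... | ()

  chromaticBound : ∀ t → Chains.BettiZero k G (t ℕ.+ r) (t ℕ.+ r ℕ.+ suc (suc t)) →
                   ChromaticAtMost G (t ℕ.+ r ℕ.+ suc (suc t) ∸ 1)
  chromaticBound t betti with colourOrWitness t (λ _ → true)
  ... | inj₁ (col , proper) = ≡.subst (ChromaticAtMost G) (cong (_∸ 1) (suc-colourBound t))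
                                       (col , λ u v → proper u v refl refl)
  ... | inj₂ w = contradiction (≡.subst (Chains.ReducedHomologyVanishes k G W) face-size
                                        (betti W (≡.trans ∣W∣≡m (suc-colourBound t))))
                               (witness⇒¬vanishes w)
    where
    open HomologyWitness w using (W; ∣W∣≡m)
    face-size : t ℕ.+ r ℕ.+ suc (suc t) ∸ (t ℕ.+ r) ∸ 1 ≡ suc t
    face-size = cong (_∸ 1) (ℕₚ.m+n∸m≡n (t ℕ.+ r) (suc (suc t)))

open import Data.Nat using (_+_; _*_)
open import Data.Nat.Solver using (module +-*-Solver)
open +-*-Solver using (solve; _:+_; _:*_; con; _:=_)

2*i+2≡i+2+i : ∀ i → 2 * i + 2 ≡ i + 2 + i
2*i+2≡i+2+i = solve 1 (λ i → con 2 :* i :+ con 2 := i :+ con 2 :+ i) refl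

decompose : ∀ {i j} → i + 2 ≤ j → j ≤ 2 * i + 2 → ∃₂ λ t r → i ≡ t + r × j ≡ i + suc (suc t)
decompose {i} i+2≤j j≤2i+2 with ℕₚ.m≤n⇒∃[o]m+o≡n i+2≤j
... | t , refl
  with ℕₚ.m≤n⇒∃[o]m+o≡n (ℕₚ.+-cancelˡ-≤ (i + 2) t i (ℕₚ.≤-trans j≤2i+2 (ℕₚ.≤-reflexive (2*i+2≡i+2+i i))))
... | r , t+r≡i = t , r , ≡.sym t+r≡i , ℕₚ.+-assoc i 2 t

mainTheorem2 : ∀ {c ℓ : Level} (k : Field c ℓ) (i j : ℕ) → i + 2 ≤ j → j ≤ 2 * i + 2 →
    ∀ {n : ℕ} (G : Graph n) → TriangleFree G → Chains.BettiZero k G i j →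
    ChromaticAtMost G (j ∸ 1)
mainTheorem2 k i j i+2≤j j≤2i+2 G triangleFree betti with decompose i+2≤j j≤2i+2
... | t , r , refl , refl = ColourOrWitness.chromaticBound k G triangleFree r t betti
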